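{- Let $k\geq 1$, $n\geq 2k+1$ and $r\geq 2$ be integers. The incidence system $\Gamma(KG(n,k),r)$ is an incidence geometry, i.e. every flag of it is contained in a chamber.
   Context: Let $\Omega=\{1,\ldots,n+k(r-2)\}$ and $I=\{1,\ldots,r\}$. The incidence system $\Gamma(KG(n,k),r)=(X,*,t,I)$ has element set $X=X_1\cup\cdots\cup X_r$, a disjoint union of $r$ copies $X_1,\ldots,X_r$ of the set of all $k$-subsets of $\Omega$; the type of $x\in X_i$ is $t(x)=i$; two elements $x\in X_i$, $y\in X_j$ are incident ($x*y$) iff $x=y$ or ($i\neq j$ and $x,y$ are disjoint as subsets of $\Omega$). A flag is a set of pairwise incident elements; its type is the set of types of its elements; a chamber is a flag of type $I$. -}

module Defs where

open import Data.Nat using (ℕ; _+_; _*_; _∸_)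
open import Data.Fin using (Fin)
open import Data.Fin.Subset using (Subset; ∣_∣; _∩_; Empty)
open import Data.Product using (Σ; _×_; ∃-syntax)
open import Data.Sum using (_⊎_)
open import Data.List using (List)
open import Data.List.Membership.Propositional using (_∈_)
open import Relation.Binary.PropositionalEquality using (_≡_; _≢_)

Ω-size : ℕ → ℕ → ℕ → ℕ
Ω-size n k r = n + k * (r ∸ 2)

-- An element of X = X_1 ∪ … ∪ X_r of Γ(KG(n,k),r):
-- a type i ∈ I = Fin r together with a k-subset of Ω.
record Elem (n k r : ℕ) : Set where
  constructor elem
  field
    type  : Fin r
    set   : Subset (Ω-size n k r)
    card  : ∣ set ∣ ≡ k
open Elem public

Disjoint : ∀ {m} → Subset m → Subset m → Set
Disjoint p q = Empty (p ∩ q)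

Incident : ∀ {n k r} → Elem n k r → Elem n k r → Set
Incident x y = (x ≡ y) ⊎ ((type x ≢ type y) × Disjoint (set x) (set y))

IsFlag : ∀ {n k r} → List (Elem n k r) → Set
IsFlag F = ∀ {x y} → x ∈ F → y ∈ F → Incident x y

IsChamber : ∀ {n k r} → List (Elem n k r) → Set
IsChamber {r = r} C = IsFlag C × (∀ (i : Fin r) → ∃[ x ] (x ∈ C × type x ≡ i))

_⊆F_ : ∀ {n k r} → List (Elem n k r) → List (Elem n k r) → Set
F ⊆F C = ∀ {x} → x ∈ F → x ∈ C

IsIncidenceGeometry : ℕ → ℕ → ℕ → Set
IsIncidenceGeometry n k r =
  (F : List (Elem n k r)) → IsFlag F → ∃[ C ] (IsChamber C × F ⊆F C)

-- Two elements of a flag with the same type coincide, so a flag meeting t types covers at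
-- most k t points of Ω. If some type i is missing then t < r, and as |Ω| = n + k (r - 2) ≥ k r
-- at least k points of Ω are uncovered; any k of them, given type i, extend the flag.
-- Adding the missing types one at a time yields a chamber.
module Submission where

open import Defs
open import Data.Nat using (ℕ; zero; suc; _+_; _*_; _≤_; _<_; z≤n; s≤s)
open import Data.Nat.Properties
  using (≤-trans; ≤-reflexive; +-suc; *-suc; *-comm; *-distribˡ-+; n≤1+n; +-monoˡ-≤; +-monoʳ-≤;
         *-monoʳ-≤; m+n≤o⇒m≤o; m+n≤o⇒m≤o∸n; module ≤-Reasoning)
open import Data.Fin using (Fin; zero; suc)
open import Data.Fin.Subset
  using (Subset; inside; outside; ∣_∣; _∪_; ⁅_⁆; ∁; ⊥; _⊆_; Empty)
  renaming (_∈_ to _∈ₛ_; _∉_ to _∉ₛ_)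
open import Data.Fin.Subset.Properties
  using (_∈?_; ∉⊥; ⊥⊆; ∣⊥∣≡0; ∈⊤; ⊆⊤; ∣⊤∣≡n; x∈⁅x⁆; x∈⁅y⁆⇒x≡y; in⊆in; out⊆; p⊆q⇒∣p∣≤∣q∣;
         p⊂q⇒∣p∣<∣q∣; x∈∁p⇒x∉p; ∣∁p∣≡n∸∣p∣; ∩-comm; x∈p∩q⁻; ∪-identityˡ; p⊆p∪q; q⊆p∪q;
         x∈p∪q⁺; x∈p∪q⁻; ∣q∣≤∣p∪q∣)
open import Data.Vec using ([]; _∷_)
  renaming (here to hereᵥ; there to thereᵥ)
open import Data.List using (List; []; _∷_; allFin)
open import Data.List.Membership.Propositional using (_∈_)
open import Data.List.Membership.Propositional.Properties using (∈-allFin)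
open import Data.List.Relation.Unary.Any using (here; there)
open import Data.Product using (_×_; _,_; ∃-syntax)
open import Data.Sum using (inj₁; inj₂; [_,_])
open import Data.Empty using (⊥-elim)
open import Relation.Nullary using (yes; no)
open import Relation.Binary.PropositionalEquality using (_≡_; refl; sym; cong; subst)

∣p∪q∣≤∣p∣+∣q∣ : ∀ {m} (p q : Subset m) → ∣ p ∪ q ∣ ≤ ∣ p ∣ + ∣ q ∣
∣p∪q∣≤∣p∣+∣q∣ []            []            = z≤n
∣p∪q∣≤∣p∣+∣q∣ (inside  ∷ p) (inside  ∷ q) = s≤s (≤-trans (∣p∪q∣≤∣p∣+∣q∣ p q) (+-monoʳ-≤ ∣ p ∣ (n≤1+n _)))
∣p∪q∣≤∣p∣+∣q∣ (inside  ∷ p) (outside ∷ q) = s≤s (∣p∪q∣≤∣p∣+∣q∣ p q)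
∣p∪q∣≤∣p∣+∣q∣ (outside ∷ p) (inside  ∷ q) = ≤-trans (s≤s (∣p∪q∣≤∣p∣+∣q∣ p q)) (≤-reflexive (sym (+-suc _ _)))
∣p∪q∣≤∣p∣+∣q∣ (outside ∷ p) (outside ∷ q) = ∣p∪q∣≤∣p∣+∣q∣ p q

x∉p⇒∣⁅x⁆∪p∣≡1+∣p∣ : ∀ {m} {x : Fin m} {p : Subset m} → x ∉ₛ p → ∣ ⁅ x ⁆ ∪ p ∣ ≡ suc ∣ p ∣
x∉p⇒∣⁅x⁆∪p∣≡1+∣p∣ {x = zero}  {inside  ∷ p} x∉p = ⊥-elim (x∉p hereᵥ)
x∉p⇒∣⁅x⁆∪p∣≡1+∣p∣ {x = zero}  {outside ∷ p} x∉p = cong (λ q → suc ∣ q ∣) (∪-identityˡ p)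
x∉p⇒∣⁅x⁆∪p∣≡1+∣p∣ {x = suc x} {inside  ∷ p} x∉p = cong suc (x∉p⇒∣⁅x⁆∪p∣≡1+∣p∣ (λ x∈p → x∉p (thereᵥ x∈p)))
x∉p⇒∣⁅x⁆∪p∣≡1+∣p∣ {x = suc x} {outside ∷ p} x∉p = x∉p⇒∣⁅x⁆∪p∣≡1+∣p∣ (λ x∈p → x∉p (thereᵥ x∈p))

k≤∣p∣⇒∃⊆-of-size : ∀ {m} k (p : Subset m) → k ≤ ∣ p ∣ → ∃[ t ] (t ⊆ p × ∣ t ∣ ≡ k)
k≤∣p∣⇒∃⊆-of-size {m} zero p _ = ⊥ , ⊥⊆ , ∣⊥∣≡0 m
k≤∣p∣⇒∃⊆-of-size (suc k) (inside ∷ p) (s≤s k≤∣p∣) with k≤∣p∣⇒∃⊆-of-size k p k≤∣p∣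
... | t , t⊆p , ∣t∣≡k = inside ∷ t , in⊆in t⊆p , cong suc ∣t∣≡k
k≤∣p∣⇒∃⊆-of-size (suc k) (outside ∷ p) k<∣p∣ with k≤∣p∣⇒∃⊆-of-size (suc k) p k<∣p∣
... | t , t⊆p , ∣t∣≡k = outside ∷ t , out⊆ t⊆p , ∣t∣≡k

∪-least : ∀ {m} {p q s : Subset m} → p ⊆ s → q ⊆ s → p ∪ q ⊆ s
∪-least {p = p} {q} p⊆s q⊆s x∈p∪q = [ p⊆s , q⊆s ] (x∈p∪q⁻ p q x∈p∪q)

Disjoint-sym : ∀ {m} {p q : Subset m} → Disjoint p q → Disjoint q p
Disjoint-sym {p = p} {q} = subst Empty (∩-comm p q)

⊆∁⇒Disjoint : ∀ {m} {p q s : Subset m} → p ⊆ ∁ s → q ⊆ s → Disjoint p q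
⊆∁⇒Disjoint {p = p} {q} p⊆∁s q⊆s (x , x∈p∩q) with x∈p∩q⁻ p q x∈p∩q
... | x∈p , x∈q = x∈∁p⇒x∉p (p⊆∁s x∈p) (q⊆s x∈q)

module _ {n k r : ℕ} where

  Incident-sym : {x y : Elem n k r} → Incident x y → Incident y x
  Incident-sym (inj₁ x≡y)            = inj₁ (sym x≡y)
  Incident-sym (inj₂ (tx≢ty , x∩y=∅)) = inj₂ ((λ ty≡tx → tx≢ty (sym ty≡tx)) , Disjoint-sym x∩y=∅)

  IsFlag-type-injective : {F : List (Elem n k r)} {x y : Elem n k r} →
    IsFlag F → x ∈ F → y ∈ F → type x ≡ type y → x ≡ y
  IsFlag-type-injective flag x∈F y∈F tx≡ty with flag x∈F y∈F
  ... | inj₁ x≡y          = x≡y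
  ... | inj₂ (tx≢ty , _) = ⊥-elim (tx≢ty tx≡ty)

  IsFlag-tail : {F : List (Elem n k r)} {x : Elem n k r} → IsFlag (x ∷ F) → IsFlag F
  IsFlag-tail flag y∈F z∈F = flag (there y∈F) (there z∈F)

  points : List (Elem n k r) → Subset (Ω-size n k r)
  points []      = ⊥
  points (x ∷ F) = set x ∪ points F

  types : List (Elem n k r) → Subset r
  types []      = ⊥
  types (x ∷ F) = ⁅ type x ⁆ ∪ types F

  set⊆points : {F : List (Elem n k r)} {x : Elem n k r} → x ∈ F → set x ⊆ points F
  set⊆points (here refl)  = p⊆p∪q _
  set⊆points (there x∈F) = λ a∈x → q⊆p∪q _ _ (set⊆points x∈F a∈x)

  type∈types : {F : List (Elem n k r)} {x : Elem n k r} → x ∈ F → type x ∈ₛ types F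
  type∈types (here refl)  = x∈p∪q⁺ (inj₁ (x∈⁅x⁆ _))
  type∈types (there x∈F) = x∈p∪q⁺ (inj₂ (type∈types x∈F))

  ∈types⇒∃ : {F : List (Elem n k r)} {i : Fin r} → i ∈ₛ types F → ∃[ x ] (x ∈ F × type x ≡ i)
  ∈types⇒∃ {[]}    i∈⊥ = ⊥-elim (∉⊥ i∈⊥)
  ∈types⇒∃ {x ∷ F} i∈T with x∈p∪q⁻ ⁅ type x ⁆ (types F) i∈T
  ... | inj₁ i∈⁅tx⁆ = x , here refl , sym (x∈⁅y⁆⇒x≡y (type x) i∈⁅tx⁆)
  ... | inj₂ i∈TF with ∈types⇒∃ i∈TF
  ...   | y , y∈F , ty≡i = y , there y∈F , ty≡i

  ∣points∣≤k*∣types∣ : {F : List (Elem n k r)} → IsFlag F → ∣ points F ∣ ≤ k * ∣ types F ∣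
  ∣points∣≤k*∣types∣ {[]}    _    = ≤-trans (≤-reflexive (∣⊥∣≡0 (Ω-size n k r))) z≤n
  ∣points∣≤k*∣types∣ {x ∷ F} flag with type x ∈? types F
  ... | yes tx∈T = begin
    ∣ set x ∪ points F ∣          ≤⟨ p⊆q⇒∣p∣≤∣q∣ (∪-least x⊆F (λ a∈F → a∈F)) ⟩
    ∣ points F ∣                  ≤⟨ ∣points∣≤k*∣types∣ (IsFlag-tail flag) ⟩
    k * ∣ types F ∣               ≤⟨ *-monoʳ-≤ k (∣q∣≤∣p∪q∣ ⁅ type x ⁆ (types F)) ⟩
    k * ∣ ⁅ type x ⁆ ∪ types F ∣  ∎
    where
    open ≤-Reasoning
    x⊆F : set x ⊆ points F
    x⊆F with ∈types⇒∃ tx∈T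
    ... | y , y∈F , ty≡tx =
      subst (λ z → set z ⊆ points F) (IsFlag-type-injective flag (there y∈F) (here refl) ty≡tx)
        (set⊆points y∈F)
  ... | no tx∉T = begin
    ∣ set x ∪ points F ∣          ≤⟨ ∣p∪q∣≤∣p∣+∣q∣ (set x) (points F) ⟩
    ∣ set x ∣ + ∣ points F ∣      ≡⟨ cong (_+ ∣ points F ∣) (card x) ⟩
    k + ∣ points F ∣              ≤⟨ +-monoʳ-≤ k (∣points∣≤k*∣types∣ (IsFlag-tail flag)) ⟩
    k + k * ∣ types F ∣           ≡⟨ *-suc k ∣ types F ∣ ⟨
    k * suc ∣ types F ∣           ≡⟨ cong (k *_) (x∉p⇒∣⁅x⁆∪p∣≡1+∣p∣ tx∉T) ⟨
    k * ∣ ⁅ type x ⁆ ∪ types F ∣  ∎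
    where open ≤-Reasoning

  ∣types∣<r : {F : List (Elem n k r)} {i : Fin r} → i ∉ₛ types F → ∣ types F ∣ < r
  ∣types∣<r {F} {i} i∉T = subst (∣ types F ∣ <_) (∣⊤∣≡n r) (p⊂q⇒∣p∣<∣q∣ (⊆⊤ , i , ∈⊤ , i∉T))

  k≤∣uncovered∣ : {F : List (Elem n k r)} {i : Fin r} → k * r ≤ Ω-size n k r →
    IsFlag F → i ∉ₛ types F → k ≤ ∣ ∁ (points F) ∣
  k≤∣uncovered∣ {F} kr≤∣Ω∣ flag i∉T =
    subst (k ≤_) (sym (∣∁p∣≡n∸∣p∣ (points F))) (m+n≤o⇒m≤o∸n k (begin
      k + ∣ points F ∣     ≤⟨ +-monoʳ-≤ k (∣points∣≤k*∣types∣ {F} flag) ⟩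
      k + k * ∣ types F ∣  ≡⟨ *-suc k ∣ types F ∣ ⟨
      k * suc ∣ types F ∣  ≤⟨ *-monoʳ-≤ k (∣types∣<r {F} i∉T) ⟩
      k * r                ≤⟨ kr≤∣Ω∣ ⟩
      Ω-size n k r         ∎))
    where open ≤-Reasoning

  IsFlag-extend : {F : List (Elem n k r)} {i : Fin r} → k * r ≤ Ω-size n k r →
    IsFlag F → i ∉ₛ types F → ∃[ x ] (type x ≡ i × IsFlag (x ∷ F))
  IsFlag-extend {F} {i} kr≤∣Ω∣ flag i∉T
    with k≤∣p∣⇒∃⊆-of-size k (∁ (points F)) (k≤∣uncovered∣ kr≤∣Ω∣ flag i∉T)
  ... | t , t⊆∁P , ∣t∣≡k = x , refl , flag′
    where
    x : Elem n k r
    x = elem i t ∣t∣≡k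
    x*F : {y : Elem n k r} → y ∈ F → Incident x y
    x*F y∈F = inj₂ ( (λ i≡ty → i∉T (subst (_∈ₛ types F) (sym i≡ty) (type∈types y∈F)))
                   , ⊆∁⇒Disjoint t⊆∁P (set⊆points y∈F))
    flag′ : IsFlag (x ∷ F)
    flag′ (here refl)  (here refl)  = inj₁ refl
    flag′ (here refl)  (there z∈F) = x*F z∈F
    flag′ (there y∈F) (here refl)  = Incident-sym (x*F y∈F)
    flag′ (there y∈F) (there z∈F) = flag y∈F z∈F

  IsFlag-cover : {F : List (Elem n k r)} → k * r ≤ Ω-size n k r → (is : List (Fin r)) →
    IsFlag F → ∃[ C ] (IsFlag C × F ⊆F C × (∀ {i} → i ∈ is → i ∈ₛ types C))
  IsFlag-cover {F} kr≤∣Ω∣ [] flag = F , flag , (λ x∈F → x∈F) , λ ()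
  IsFlag-cover kr≤∣Ω∣ (i ∷ is) flag with IsFlag-cover kr≤∣Ω∣ is flag
  ... | C , flagC , F⊆C , covers with i ∈? types C
  ...   | yes i∈T = C , flagC , F⊆C , λ where
          (here refl)   → i∈T
          (there j∈is) → covers j∈is
  ...   | no i∉T with IsFlag-extend kr≤∣Ω∣ flagC i∉T
  ...     | x , refl , flagxC = x ∷ C , flagxC , (λ y∈F → there (F⊆C y∈F)) , λ where
          (here refl)   → type∈types {x ∷ C} (here refl)
          (there j∈is) → q⊆p∪q ⁅ type x ⁆ (types C) (covers j∈is)

kr≤∣Ω∣ : ∀ n k r → 2 * k + 1 ≤ n → 2 ≤ r → k * r ≤ Ω-size n k r
kr≤∣Ω∣ n k (suc (suc r)) 2k+1≤n (s≤s (s≤s z≤n)) = begin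
  k * (2 + r)    ≡⟨ *-distribˡ-+ k 2 r ⟩
  k * 2 + k * r  ≤⟨ +-monoˡ-≤ (k * r) 2k≤n ⟩
  n + k * r      ∎
  where
  open ≤-Reasoning
  2k≤n : k * 2 ≤ n
  2k≤n = subst (_≤ n) (*-comm 2 k) (m+n≤o⇒m≤o (2 * k) 2k+1≤n)

lemma4p2 : (n k r : ℕ) → 1 ≤ k → 2 * k + 1 ≤ n → 2 ≤ r → IsIncidenceGeometry n k r
lemma4p2 n k r _ 2k+1≤n 2≤r F flag
  with IsFlag-cover (kr≤∣Ω∣ n k r 2k+1≤n 2≤r) (allFin r) flag
... | C , flagC , F⊆C , covers = C , (flagC , λ i → ∈types⇒∃ (covers (∈-allFin i))) , F⊆C
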